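{- There are reals $A,B\in\{0,1\}^\omega$ such that $A$ is $\mathrm{BP}$ random relative to $B$ and $B$ is $\mathrm{BP}$ random relative to $A$, but $A\oplus B$ is not $\mathrm{BP}$ random.
   Context: Sets/reals are identified with characteristic sequences. $A\oplus B=\{2x:x\in A\}\cup\{2x+1:x\in B\}$. $[\sigma]$ is the set of reals extending the string $\sigma$, $[G]=\bigcup_{\sigma\in G}[\sigma]$, and $\mu$ is the uniform measure. A primitive recursive test is a sequence of clopen sets $U_n=[G_n]$, with finite sets $G_n$ given by a primitive recursive function and $\mu(U_n)\le2^{ -n}$. $X$ is $\mathrm{BP}$ random if for every primitive recursive test there is $n$ with $X\notin U_n$. A primitive recursive oracle machine is an oracle Turing machine $M^Z$ whose running time on input $x$ is bounded by $g(x)$, for a primitive recursive $g$, for all oracles $Z$. A primitive recursive oracle test is given by a function $g^Z$ computed by such a machine and a primitive recursive $f$ such that, for every real $Z$ and $n$, $g^Z(n)$ codes a finite set $G^Z_n\subseteq\{0,1\}^{f(n)}$ with $\mu([G^Z_n])<2^{ -n}$. $X$ is $\mathrm{BP}$ random relative to $Y$ if for every primitive recursive oracle test there is $n$ with $X\notin[G^Y_n]$. Equivalently, $X$ is $\mathrm{BP}$ random relative to $Y$ iff there do not exist a primitive recursive oracle machine $M$ and a primitive recursive $f$ with $C^Y_M(X\upharpoonright f(c))\le f(c)-c$ for all $c$. Here $C^Y_M(\tau)$ is the least $|\sigma|$ with $M^Y(\sigma)=\tau$. -}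

module Defs where

open import Data.Bool using (Bool; true; false; if_then_else_)
open import Data.Nat using (ℕ; zero; suc; _+_; _*_; _^_; _≤_; _<_; _/_; _%_; _≡ᵇ_)
open import Data.Fin using (Fin) renaming (zero to fzero; suc to fsuc)
open import Data.Vec using (Vec; []; _∷_; lookup; tabulate)
open import Data.List using (List; []; _∷_; map; upTo; concatMap; inits; length)
open import Data.Bool.ListAction using (any)
open import Data.Product using (Σ; _×_)
open import Relation.Binary.PropositionalEquality using (_≡_)
open import Relation.Nullary using (¬_)

Real : Set
Real = ℕ → Bool

-- (A ⊕ B)(2x) = A x ,  (A ⊕ B)(2x+1) = B x
_⊕_ : Real → Real → Real
(A ⊕ B) zero = A zero
(A ⊕ B) (suc zero) = B zero
(A ⊕ B) (suc (suc n)) = ((λ k → A (suc k)) ⊕ (λ k → B (suc k))) n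

_↾_ : Real → ℕ → List Bool
X ↾ n = map X (upTo n)

allStrings : ℕ → List (List Bool)
allStrings zero = [] ∷ []
allStrings (suc n) = concatMap (λ σ → (false ∷ σ) ∷ (true ∷ σ) ∷ []) (allStrings n)

countTrue : List Bool → ℕ
countTrue [] = 0
countTrue (true ∷ bs) = suc (countTrue bs)
countTrue (false ∷ bs) = countTrue bs

count : {A : Set} → (A → Bool) → List A → ℕ
count p xs = countTrue (map p xs)

-- bijection {0,1}^* → ℕ (bijective base 2)
natOfStr : List Bool → ℕ
natOfStr [] = 0
natOfStr (b ∷ σ) = suc (2 * natOfStr σ + (if b then 1 else 0))

bit : ℕ → ℕ → Bool
bit c zero = (c % 2) ≡ᵇ 1
bit c (suc i) = bit (c / 2) i

-- c codes the finite set D_c = { σ : bit c (natOfStr σ) = true }  (canonical index)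
_∈D_ : List Bool → ℕ → Bool
σ ∈D c = bit c (natOfStr σ)

_∈[D_] : Real → ℕ → Set
X ∈[D c ] = Σ ℕ (λ m → ((X ↾ m) ∈D c) ≡ true)

coveredBy : ℕ → List Bool → Bool
coveredBy c τ = any (λ σ → σ ∈D c) (inits τ)

-- PRF false n : n-ary primitive recursive functions;
-- PRF true n : n-ary functionals primitive recursive in an oracle Z.

data PRF : Bool → ℕ → Set where
  zeroF : ∀ {o n} → PRF o n
  succF : ∀ {o} → PRF o 1
  proj  : ∀ {o n} → Fin n → PRF o n
  comp  : ∀ {o m n} → PRF o m → (Fin m → PRF o n) → PRF o n
  prec  : ∀ {o n} → PRF o n → PRF o (suc (suc n)) → PRF o (suc n)
  orc   : PRF true 1

evalPR : ∀ {o n} → PRF o n → Real → Vec ℕ n → ℕ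
evalPR zeroF Z xs = 0
evalPR succF Z (x ∷ []) = suc x
evalPR (proj i) Z xs = lookup xs i
evalPR (comp h gs) Z xs = evalPR h Z (tabulate (λ i → evalPR (gs i) Z xs))
evalPR (prec g h) Z (y ∷ xs) = iter y
  where
  iter : ℕ → ℕ
  iter zero = evalPR g Z xs
  iter (suc k) = evalPR h Z (k ∷ iter k ∷ xs)
evalPR orc Z (x ∷ []) = if Z x then 1 else 0

pr : PRF false 1 → ℕ → ℕ
pr t n = evalPR t (λ _ → false) (n ∷ [])

prO : PRF true 1 → Real → ℕ → ℕ
prO t Z n = evalPR t Z (n ∷ [])

-- t is a primitive recursive test: U_n = [D_{t(n)}] with μ(U_n) ≤ 2^{-n}.
-- μ([G]) ≤ 2^{-n} iff for every L the fraction of strings of length L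
-- extending a member of G is ≤ 2^{-n}.
IsPRTest : PRF false 1 → Set
IsPRTest t = ∀ n L → count (coveredBy (pr t n)) (allStrings L) * 2 ^ n ≤ 2 ^ L

BPRandom : Real → Set
BPRandom X = (t : PRF false 1) → IsPRTest t → Σ ℕ (λ n → ¬ (X ∈[D pr t n ]))

-- primitive recursive oracle test (g, f): G^Z_n = D_{g^Z(n)} ∩ {0,1}^{f(n)},
-- with μ([G^Z_n]) = |G^Z_n| / 2^{f(n)} < 2^{-n} for all Z, n.
IsOracleTest : PRF true 1 → PRF false 1 → Set
IsOracleTest g f = ∀ (Z : Real) n →
  count (λ σ → σ ∈D prO g Z n) (allStrings (pr f n)) * 2 ^ n < 2 ^ pr f n

-- X ∈ [G^Y_n]  iff  X ↾ f(n) ∈ G^Y_n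
BPRandomRel : Real → Real → Set
BPRandomRel X Y = (g : PRF true 1) (f : PRF false 1) → IsOracleTest g f →
  Σ ℕ (λ n → ¬ (((X ↾ pr f n) ∈D prO g Y n) ≡ true))

-- Disjoint reals A and B make A ⊕ B pair-free: no block (A i , B i) is (1 , 1). Only 3 ^ (3n) of the
-- strings of length 6n are pair-free, a set of measure (27/64) ^ n ≤ 2 ^ -n, and the canonical index of
-- that set is primitive recursive in n; so A ⊕ B fails a primitive recursive test.
--
-- A and B are built by finite extension, meeting the primitive recursive oracle tests one at a time.
-- When both are fixed below ℓ, cut the oracle B to its first ℓ bits followed by zeros. Relative to this
-- oracle the ℓ-th level of the test has measure < 2 ^ -ℓ, so some extension of A ↾ ℓ avoids it. Fixing
-- both reals up to that extension and up to the use of the oracle computation makes the escape permanent,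
-- and the zeros written into B keep A and B disjoint. Then the roles of A and B are exchanged.

module Submission where

open import Defs
open import Data.Bool using (Bool; true; false; not; _∧_; if_then_else_)
open import Data.Bool.Properties using (∧-assoc; ∧-comm; ∧-identityʳ; ∧-zeroʳ)
open import Data.Bool.ListAction using (any; or)
open import Data.Nat
open import Data.Nat.Properties
open import Data.Nat.Divisibility using (divides)
open import Data.Nat.DivMod using ([m+kn]%n≡m%n; +-distrib-/-∣ʳ; m*n/n≡m; m<n*o⇒m/o<n)
open import Data.Nat.Solver using (module +-*-Solver)
open import Data.Fin using (Fin; toℕ) renaming (zero to fzero; suc to fsuc)
open import Data.Vec using (Vec; []; _∷_; tabulate; lookup)
open import Data.Vec.Properties using (tabulate-cong)
open import Data.List using (List; []; _∷_; _++_; length; take; map; inits; upTo; applyUpTo; concatMap)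
open import Data.List.Properties using (length-++; length-map; length-take; length-upTo; map-upTo; map-∘; take-map)
open import Data.Sum using (inj₁; inj₂)
open import Data.Product using (Σ; ∃; _×_; _,_; proj₁; proj₂) renaming (swap to ×-swap)
open import Function using (id)
open import Relation.Binary.PropositionalEquality
open import Relation.Binary.Definitions using (tri<; tri≈; tri>)
open import Relation.Nullary using (¬_; contradiction; yes; no)
open +-*-Solver using (solve; _:*_; _:+_; con; _:=_)

-- Primitive recursive functions

noOracle : Real
noOracle _ = false

Computes₂ : ∀ {o} → PRF o 2 → (ℕ → ℕ → ℕ) → Set
Computes₂ t _∙_ = ∀ Z x y → evalPR t Z (x ∷ y ∷ []) ≡ x ∙ y

_⟨_,_⟩ : ∀ {o n} → PRF o 2 → PRF o n → PRF o n → PRF o n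
h ⟨ a , b ⟩ = comp h λ { fzero → a ; (fsuc _) → b }

constPR : ∀ {o n} → ℕ → PRF o n
constPR zero = zeroF
constPR (suc k) = comp succF (λ _ → constPR k)

evalPR-constPR : ∀ {o n} k Z (xs : Vec ℕ n) → evalPR {o} (constPR k) Z xs ≡ k
evalPR-constPR zero Z xs = refl
evalPR-constPR (suc k) Z xs = cong suc (evalPR-constPR k Z xs)

addPR : ∀ {o} → PRF o 2
addPR = prec (proj fzero) (comp succF λ _ → proj (fsuc fzero))

addPR-computes : ∀ {o} → Computes₂ {o} addPR _+_
addPR-computes Z zero x = refl
addPR-computes Z (suc y) x = cong suc (addPR-computes Z y x)

mulPR : ∀ {o} → PRF o 2
mulPR = prec zeroF (addPR ⟨ proj (fsuc (fsuc fzero)) , proj (fsuc fzero) ⟩)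

mulPR-computes : ∀ {o} → Computes₂ {o} mulPR _*_
mulPR-computes Z zero x = refl
mulPR-computes Z (suc y) x = trans (addPR-computes Z x _) (cong (x +_) (mulPR-computes Z y x))

powPR : ∀ {o} → PRF o 2
powPR = prec (constPR 1) (mulPR ⟨ proj (fsuc (fsuc fzero)) , proj (fsuc fzero) ⟩)

powPR-computes : ∀ {o} → Computes₂ {o} powPR (λ y x → x ^ y)
powPR-computes {o} Z zero x = evalPR-constPR {o} 1 Z (x ∷ [])
powPR-computes Z (suc y) x = trans (mulPR-computes Z x _) (cong (x *_) (powPR-computes Z y x))

PrimRec : (ℕ → ℕ) → Set
PrimRec h = Σ (PRF false 1) λ t → ∀ n → pr t n ≡ h n

primRec-id : PrimRec (λ n → n)
primRec-id = proj fzero , λ _ → refl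

primRec-const : ∀ k → PrimRec (λ _ → k)
primRec-const k = constPR k , λ n → evalPR-constPR k noOracle (n ∷ [])

primRec-∘ : ∀ {h k} → PrimRec h → PrimRec k → PrimRec (λ n → h (k n))
primRec-∘ {h} (s , s≗h) (t , t≗k) = comp s (λ _ → t) , λ n → trans (s≗h (pr t n)) (cong h (t≗k n))

primRec-pred : ∀ {h} → PrimRec h → PrimRec (λ n → pred (h n))
primRec-pred = primRec-∘ {pred} (prec zeroF (proj fzero) , λ { zero → refl ; (suc n) → refl })

primRec-op : ∀ {_∙_ h k} (t : PRF false 2) → Computes₂ t _∙_ →
             PrimRec h → PrimRec k → PrimRec (λ n → h n ∙ k n)
primRec-op {_∙_} t t-computes (s , s≗h) (u , u≗k) =
  t ⟨ s , u ⟩ , λ n → trans (t-computes noOracle (pr s n) (pr u n)) (cong₂ _∙_ (s≗h n) (u≗k n))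

primRec-+ : ∀ {h k} → PrimRec h → PrimRec k → PrimRec (λ n → h n + k n)
primRec-+ = primRec-op addPR addPR-computes

primRec-* : ∀ {h k} → PrimRec h → PrimRec k → PrimRec (λ n → h n * k n)
primRec-* = primRec-op mulPR mulPR-computes

primRec-^ : ∀ {h k} → PrimRec h → PrimRec k → PrimRec (λ n → h n ^ k n)
primRec-^ h-pr k-pr = primRec-op powPR powPR-computes k-pr h-pr

prodBelow : (ℕ → ℕ) → ℕ → ℕ
prodBelow h zero = 1
prodBelow h (suc n) = prodBelow h n * h n

primRec-prodBelow : ∀ {h} → PrimRec h → PrimRec (prodBelow h)
primRec-prodBelow {h} (t , t≗h) = product , product≗
  where
  product : PRF false 1
  product = prec (constPR 1) (mulPR ⟨ proj (fsuc fzero) , comp t (λ _ → proj fzero) ⟩)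
  product≗ : ∀ n → pr product n ≡ prodBelow h n
  product≗ zero = evalPR-constPR {false} 1 noOracle []
  product≗ (suc n) = trans (mulPR-computes noOracle (pr product n) (pr t n)) (cong₂ _*_ (product≗ n) (t≗h n))

-- Binary digits and canonical indices

bit-zero : ∀ i → bit 0 i ≡ false
bit-zero zero = refl
bit-zero (suc i) = bit-zero i

bit-+*2-zero : ∀ x z → bit (x + z * 2) 0 ≡ bit x 0
bit-+*2-zero x z = cong (_≡ᵇ 1) ([m+kn]%n≡m%n x z 2)

bit-+*2-suc : ∀ x z i → bit (x + z * 2) (suc i) ≡ bit (x / 2 + z) i
bit-+*2-suc x z i =
  cong (λ v → bit v i) (trans (+-distrib-/-∣ʳ x (divides z refl)) (cong (x / 2 +_) (m*n/n≡m z 2)))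

private
  2^suc-* : ∀ a y → 2 ^ suc a * y ≡ 2 ^ a * y * 2
  2^suc-* a y = solve 2 (λ p y → con 2 :* p :* y := p :* y :* con 2) refl (2 ^ a) y

  /2<2^ : ∀ a {x} → x < 2 ^ suc a → x / 2 < 2 ^ a
  /2<2^ a {x} x< = m<n*o⇒m/o<n (subst (x <_) (*-comm 2 (2 ^ a)) x<)

bit-low : ∀ a {x} y {i} → x < 2 ^ a → i < a → bit (x + 2 ^ a * y) i ≡ bit x i
bit-low (suc a) {x} y {zero} _ _ =
  trans (cong (λ v → bit (x + v) 0) (2^suc-* a y)) (bit-+*2-zero x (2 ^ a * y))
bit-low (suc a) {x} y {suc i} x< (s≤s i<a) =
  trans (cong (λ v → bit (x + v) (suc i)) (2^suc-* a y))
        (trans (bit-+*2-suc x (2 ^ a * y) i) (bit-low a y (/2<2^ a x<) i<a))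

bit-high : ∀ a {x} y j → x < 2 ^ a → bit (x + 2 ^ a * y) (a + j) ≡ bit y j
bit-high zero {zero} y j _ = cong (λ v → bit v j) (+-identityʳ y)
bit-high zero {suc x} y j (s≤s ())
bit-high (suc a) {x} y j x< =
  trans (cong (λ v → bit (x + v) (suc a + j)) (2^suc-* a y))
        (trans (bit-+*2-suc x (2 ^ a * y) (a + j)) (bit-high a y j (/2<2^ a x<)))

bit-beyond : ∀ {x} i → x < 2 ^ i → bit x i ≡ false
bit-beyond {x} i x< = begin
    bit x i
  ≡⟨ cong₂ bit (sym (trans (cong (x +_) (*-zeroʳ (2 ^ i))) (+-identityʳ x))) (sym (+-identityʳ i)) ⟩
    bit (x + 2 ^ i * 0) (i + 0)
  ≡⟨ bit-high i 0 0 x< ⟩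
    false ∎
  where open ≡-Reasoning

bit-shift-true : ∀ a y i → bit (2 ^ a * y) i ≡ true → ∃ λ j → i ≡ a + j × bit y j ≡ true
bit-shift-true a y i bit-true with <-≤-connex i a
... | inj₁ i<a with () ← trans (sym (bit-zero i)) (trans (sym (bit-low a y (m^n>0 2 a) i<a)) bit-true)
... | inj₂ a≤i = i ∸ a , sym (m+[n∸m]≡n a≤i) ,
                 trans (sym (bit-high a y (i ∸ a) (m^n>0 2 a)))
                       (trans (cong (bit (2 ^ a * y)) (m+[n∸m]≡n a≤i)) bit-true)

digit : Bool → ℕ
digit b = if b then 1 else 0

digit<2 : ∀ b → digit b < 2
digit<2 true = s≤s (s≤s z≤n)
digit<2 false = s≤s z≤n

bin : List Bool → ℕ
bin [] = 0
bin (b ∷ σ) = digit b + 2 * bin σ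

suc-natOfStr : ∀ σ → suc (natOfStr σ) ≡ 2 ^ length σ + bin σ
suc-natOfStr [] = refl
suc-natOfStr (b ∷ σ) = begin
    suc (suc (2 * natOfStr σ + digit b))
  ≡⟨ solve 2 (λ N d → con 2 :+ (con 2 :* N :+ d) := con 2 :* (con 1 :+ N) :+ d)
            refl (natOfStr σ) (digit b) ⟩
    2 * suc (natOfStr σ) + digit b
  ≡⟨ cong (λ v → 2 * v + digit b) (suc-natOfStr σ) ⟩
    2 * (2 ^ length σ + bin σ) + digit b
  ≡⟨ solve 3 (λ P B d → con 2 :* (P :+ B) :+ d := con 2 :* P :+ (d :+ con 2 :* B))
            refl (2 ^ length σ) (bin σ) (digit b) ⟩
    2 ^ length (b ∷ σ) + bin (b ∷ σ) ∎
  where open ≡-Reasoning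

+-*2^-bound : ∀ a b {x y} → x < 2 ^ a → y < 2 ^ b → x + 2 ^ a * y < 2 ^ (a + b)
+-*2^-bound a b {x} {y} x< y< = begin-strict
    x + 2 ^ a * y
  <⟨ +-monoˡ-< (2 ^ a * y) x< ⟩
    2 ^ a + 2 ^ a * y
  ≡⟨ sym (*-suc (2 ^ a) y) ⟩
    2 ^ a * suc y
  ≤⟨ *-monoʳ-≤ (2 ^ a) y< ⟩
    2 ^ a * 2 ^ b
  ≡⟨ sym (^-distribˡ-+-* 2 a b) ⟩
    2 ^ (a + b) ∎
  where open ≤-Reasoning

bin<2^length : ∀ σ → bin σ < 2 ^ length σ
bin<2^length [] = s≤s z≤n
bin<2^length (b ∷ σ) = +-*2^-bound 1 (length σ) (digit<2 b) (bin<2^length σ)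

bin-++ : ∀ ρ τ → bin (ρ ++ τ) ≡ bin ρ + 2 ^ length ρ * bin τ
bin-++ [] τ = sym (+-identityʳ (bin τ))
bin-++ (b ∷ ρ) τ = trans (cong (λ v → digit b + 2 * v) (bin-++ ρ τ))
  (solve 4 (λ d B P T → d :+ con 2 :* (B :+ P :* T) := (d :+ con 2 :* B) :+ (con 2 :* P) :* T)
         refl (digit b) (bin ρ) (2 ^ length ρ) (bin τ))

2^+<2^ : ∀ {a b x} → x < 2 ^ a → a < b → 2 ^ a + x < 2 ^ b
2^+<2^ {a} {b} {x} x< a<b = begin-strict
    2 ^ a + x
  <⟨ +-monoʳ-< (2 ^ a) x< ⟩
    2 ^ a + 2 ^ a
  ≡⟨ cong (2 ^ a +_) (sym (+-identityʳ (2 ^ a))) ⟩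
    2 ^ suc a
  ≤⟨ ^-monoʳ-≤ 2 a<b ⟩
    2 ^ b ∎
  where open ≤-Reasoning

binaryLength-unique : ∀ {a b x y} → 2 ^ a + x ≡ 2 ^ b + y → x < 2 ^ a → y < 2 ^ b → a ≡ b
binaryLength-unique {a} {b} {x} {y} eq x< y< with <-cmp a b
... | tri< a<b _ _ = contradiction (subst (_< 2 ^ b) eq (2^+<2^ x< a<b)) (≤⇒≯ (m≤m+n (2 ^ b) y))
... | tri≈ _ a≡b _ = a≡b
... | tri> _ _ b<a = contradiction (subst (_< 2 ^ a) (sym eq) (2^+<2^ y< b<a)) (≤⇒≯ (m≤m+n (2 ^ a) x))

-- The strings of length M have canonical indices 2 ^ M ∸ 1 + bin σ, so levelCode M Q codes those
-- of them whose bit bin σ in Q is set.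
levelCode : ℕ → ℕ → ℕ
levelCode M Q = 2 ^ (2 ^ M ∸ 1) * Q

natOfStr-level : ∀ {M} σ → length σ ≡ M → natOfStr σ ≡ (2 ^ M ∸ 1) + bin σ
natOfStr-level {M} σ refl = suc-injective (begin
    suc (natOfStr σ)
  ≡⟨ suc-natOfStr σ ⟩
    2 ^ M + bin σ
  ≡⟨ cong (_+ bin σ) (sym (m+[n∸m]≡n (m^n>0 2 M))) ⟩
    suc (2 ^ M ∸ 1) + bin σ ∎)
  where open ≡-Reasoning

∈D-levelCode : ∀ {M} Q σ → length σ ≡ M → σ ∈D levelCode M Q ≡ bit Q (bin σ)
∈D-levelCode {M} Q σ len = trans (cong (bit (levelCode M Q)) (natOfStr-level σ len))
                                 (bit-high (2 ^ M ∸ 1) Q (bin σ) (m^n>0 2 (2 ^ M ∸ 1)))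

levelCode-length : ∀ {M Q} σ → Q < 2 ^ 2 ^ M → σ ∈D levelCode M Q ≡ true → length σ ≡ M
levelCode-length {M} {Q} σ Q< σ∈ with bit-shift-true (2 ^ M ∸ 1) Q (natOfStr σ) σ∈
... | j , index≡ , bit-true = binaryLength-unique 2^L+bin≡2^M+j (bin<2^length σ) j<2^M
  where
  open ≡-Reasoning
  j<2^M : j < 2 ^ M
  j<2^M with <-≤-connex j (2 ^ M)
  ... | inj₁ j< = j<
  ... | inj₂ 2^M≤j with () ← trans (sym bit-true) (bit-beyond j (<-≤-trans Q< (^-monoʳ-≤ 2 2^M≤j)))
  2^L+bin≡2^M+j : 2 ^ length σ + bin σ ≡ 2 ^ M + j
  2^L+bin≡2^M+j = begin
      2 ^ length σ + bin σ
    ≡⟨ sym (suc-natOfStr σ) ⟩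
      suc (natOfStr σ)
    ≡⟨ cong suc index≡ ⟩
      suc (2 ^ M ∸ 1) + j
    ≡⟨ cong (_+ j) (m+[n∸m]≡n (m^n>0 2 M)) ⟩
      2 ^ M + j ∎

-- Counting strings

count-∷ : ∀ {A : Set} (p : A → Bool) x xs → count p (x ∷ xs) ≡ digit (p x) + count p xs
count-∷ p x xs with p x
... | true = refl
... | false = refl

count-allStrings-suc : ∀ (p : List Bool → Bool) k → count p (allStrings (suc k)) ≡
  count (λ σ → p (false ∷ σ)) (allStrings k) + count (λ σ → p (true ∷ σ)) (allStrings k)
count-allStrings-suc p k = go (allStrings k)
  where
  open ≡-Reasoning
  p₀ p₁ : List Bool → Bool
  p₀ σ = p (false ∷ σ)
  p₁ σ = p (true ∷ σ)
  go : ∀ xs → count p (concatMap (λ σ → (false ∷ σ) ∷ (true ∷ σ) ∷ []) xs) ≡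
              count p₀ xs + count p₁ xs
  go [] = refl
  go (σ ∷ xs) = begin
      count p ((false ∷ σ) ∷ (true ∷ σ) ∷ _)
    ≡⟨ count-∷ p _ _ ⟩
      digit (p₀ σ) + count p ((true ∷ σ) ∷ _)
    ≡⟨ cong (digit (p₀ σ) +_) (count-∷ p _ _) ⟩
      digit (p₀ σ) + (digit (p₁ σ) + count p (concatMap _ xs))
    ≡⟨ cong (λ v → digit (p₀ σ) + (digit (p₁ σ) + v)) (go xs) ⟩
      digit (p₀ σ) + (digit (p₁ σ) + (count p₀ xs + count p₁ xs))
    ≡⟨ solve 4 (λ a b c d → a :+ (b :+ (c :+ d)) := (a :+ c) :+ (b :+ d)) refl
             (digit (p₀ σ)) (digit (p₁ σ)) (count p₀ xs) (count p₁ xs) ⟩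
      (digit (p₀ σ) + count p₀ xs) + (digit (p₁ σ) + count p₁ xs)
    ≡⟨ sym (cong₂ _+_ (count-∷ p₀ σ xs) (count-∷ p₁ σ xs)) ⟩
      count p₀ (σ ∷ xs) + count p₁ (σ ∷ xs) ∎

count-const : ∀ b k → count (λ _ → b) (allStrings k) ≡ digit b * 2 ^ k
count-const b zero =
  trans (count-∷ {List Bool} (λ _ → b) [] []) (trans (+-identityʳ (digit b)) (sym (*-identityʳ (digit b))))
count-const b (suc k) = begin
    count (λ _ → b) (allStrings (suc k))
  ≡⟨ count-allStrings-suc (λ _ → b) k ⟩
    count (λ _ → b) (allStrings k) + count (λ _ → b) (allStrings k)
  ≡⟨ cong (λ v → v + v) (count-const b k) ⟩
    digit b * 2 ^ k + digit b * 2 ^ k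
  ≡⟨ solve 2 (λ d p → d :* p :+ d :* p := d :* (con 2 :* p)) refl (digit b) (2 ^ k) ⟩
    digit b * 2 ^ suc k ∎
  where open ≡-Reasoning

count-mono : ∀ k {p q : List Bool → Bool} → (∀ σ → length σ ≡ k → p σ ≡ true → q σ ≡ true) →
             count p (allStrings k) ≤ count q (allStrings k)
count-mono zero {p} {q} p⇒q with p [] in p[]
... | true rewrite p⇒q [] refl p[] = ≤-refl
... | false = z≤n
count-mono (suc k) {p} {q} p⇒q = begin
    count p (allStrings (suc k))
  ≡⟨ count-allStrings-suc p k ⟩
    count (λ σ → p (false ∷ σ)) (allStrings k) + count (λ σ → p (true ∷ σ)) (allStrings k)
  ≤⟨ +-mono-≤ (count-mono k (λ σ len → p⇒q (false ∷ σ) (cong suc len)))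
              (count-mono k (λ σ len → p⇒q (true ∷ σ) (cong suc len))) ⟩
    count (λ σ → q (false ∷ σ)) (allStrings k) + count (λ σ → q (true ∷ σ)) (allStrings k)
  ≡⟨ sym (count-allStrings-suc q k) ⟩
    count q (allStrings (suc k)) ∎
  where open ≤-Reasoning

count-prefix : ∀ m k (p : List Bool → Bool) →
               count (λ τ → p (take m τ)) (allStrings (m + k)) ≡ count p (allStrings m) * 2 ^ k
count-prefix zero k p =
  trans (count-const (p []) k) (cong (_* 2 ^ k) (sym (trans (count-∷ p [] []) (+-identityʳ (digit (p []))))))
count-prefix (suc m) k p = begin
    count (λ τ → p (take (suc m) τ)) (allStrings (suc (m + k)))
  ≡⟨ count-allStrings-suc (λ τ → p (take (suc m) τ)) (m + k) ⟩
    count (λ τ → p₀ (take m τ)) (allStrings (m + k)) + count (λ τ → p₁ (take m τ)) (allStrings (m + k))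
  ≡⟨ cong₂ _+_ (count-prefix m k p₀) (count-prefix m k p₁) ⟩
    count p₀ (allStrings m) * 2 ^ k + count p₁ (allStrings m) * 2 ^ k
  ≡⟨ sym (*-distribʳ-+ (2 ^ k) (count p₀ (allStrings m)) (count p₁ (allStrings m))) ⟩
    (count p₀ (allStrings m) + count p₁ (allStrings m)) * 2 ^ k
  ≡⟨ cong (_* 2 ^ k) (sym (count-allStrings-suc p m)) ⟩
    count p (allStrings (suc m)) * 2 ^ k ∎
  where
  open ≡-Reasoning
  p₀ p₁ : List Bool → Bool
  p₀ σ = p (false ∷ σ)
  p₁ σ = p (true ∷ σ)

count-extensions : ∀ (p : List Bool → Bool) α k →
                   count (λ ρ → p (α ++ ρ)) (allStrings k) ≤ count p (allStrings (length α + k))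
count-extensions p [] k = ≤-refl
count-extensions p (false ∷ α) k = ≤-trans (count-extensions (λ σ → p (false ∷ σ)) α k)
  (≤-trans (m≤m+n _ _) (≤-reflexive (sym (count-allStrings-suc p (length α + k)))))
count-extensions p (true ∷ α) k = ≤-trans (count-extensions (λ σ → p (true ∷ σ)) α k)
  (≤-trans (m≤n+m _ _) (≤-reflexive (sym (count-allStrings-suc p (length α + k)))))

sparse⇒avoidable : ∀ (p : List Bool → Bool) k → count p (allStrings k) < 2 ^ k →
                   ∃ λ σ → length σ ≡ k × p σ ≡ false
sparse⇒avoidable p zero few with p [] in p[]
... | false = [] , refl , p[]
... | true = contradiction few (<-irrefl refl)
sparse⇒avoidable p (suc k) few with count (λ σ → p (false ∷ σ)) (allStrings k) <? 2 ^ k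
... | yes few₀ = let σ , len , avoids = sparse⇒avoidable _ k few₀ in false ∷ σ , cong suc len , avoids
... | no many₀ = let σ , len , avoids = sparse⇒avoidable _ k few₁ in true ∷ σ , cong suc len , avoids
  where
  few₁ : count (λ σ → p (true ∷ σ)) (allStrings k) < 2 ^ k
  few₁ = +-cancelˡ-< (2 ^ k) _ _ (begin-strict
      2 ^ k + count (λ σ → p (true ∷ σ)) (allStrings k)
    ≤⟨ +-monoˡ-≤ _ (≮⇒≥ many₀) ⟩
      count (λ σ → p (false ∷ σ)) (allStrings k) + count (λ σ → p (true ∷ σ)) (allStrings k)
    ≡⟨ sym (count-allStrings-suc p k) ⟩
      count p (allStrings (suc k))
    <⟨ few ⟩
      2 ^ k + (2 ^ k + 0)
    ≡⟨ cong (2 ^ k +_) (+-identityʳ (2 ^ k)) ⟩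
      2 ^ k + 2 ^ k ∎)
    where open ≤-Reasoning

avoider : (List Bool → Bool) → ℕ → List Bool
avoider p k with count p (allStrings k) <? 2 ^ k
... | yes few = proj₁ (sparse⇒avoidable p k few)
... | no _ = []

avoider-avoids : ∀ p k → count p (allStrings k) < 2 ^ k →
                 length (avoider p k) ≡ k × p (avoider p k) ≡ false
avoider-avoids p k few with count p (allStrings k) <? 2 ^ k
... | yes few′ = proj₂ (sparse⇒avoidable p k few′)
... | no many = contradiction few many

-- The pair-free test

pairFree : List Bool → Bool
pairFree (a ∷ b ∷ σ) = not (a ∧ b) ∧ pairFree σ
pairFree _ = true

split-last-two : ∀ {A : Set} m (σ : List A) → length σ ≡ suc (suc m) →
                 ∃ λ ρ → ∃ λ a → ∃ λ b → σ ≡ ρ ++ a ∷ b ∷ [] × length ρ ≡ m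
split-last-two zero (a ∷ b ∷ []) refl = [] , a , b , refl , refl
split-last-two (suc m) (c ∷ σ) len with split-last-two m σ (suc-injective len)
... | ρ , a , b , σ≡ , ρ-len = c ∷ ρ , a , b , cong (c ∷_) σ≡ , cong suc ρ-len

pairFree-++ : ∀ J ρ a b → length ρ ≡ J * 2 → pairFree (ρ ++ a ∷ b ∷ []) ≡ pairFree ρ ∧ not (a ∧ b)
pairFree-++ zero [] a b _ = ∧-identityʳ (not (a ∧ b))
pairFree-++ (suc J) (c ∷ d ∷ ρ) a b len =
  trans (cong (not (c ∧ d) ∧_) (pairFree-++ J ρ a b (suc-injective (suc-injective len))))
        (sym (∧-assoc (not (c ∧ d)) (pairFree ρ) (not (a ∧ b))))

threeCopies : ℕ → ℕ → ℕ
threeCopies E Q = Q + 2 ^ E * (Q + 2 ^ E * Q)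

bit-threeCopies : ∀ E {Q p} → Q < 2 ^ E → p < E → ∀ a b →
                  bit (threeCopies E Q) (p + E * bin (a ∷ b ∷ [])) ≡ bit Q p ∧ not (a ∧ b)
bit-threeCopies E {Q} {p} Q< p<E false false = begin
    bit (threeCopies E Q) (p + E * 0)
  ≡⟨ cong (bit (threeCopies E Q)) (trans (cong (p +_) (*-zeroʳ E)) (+-identityʳ p)) ⟩
    bit (threeCopies E Q) p
  ≡⟨ bit-low E _ Q< p<E ⟩
    bit Q p
  ≡⟨ sym (∧-identityʳ (bit Q p)) ⟩
    bit Q p ∧ true ∎
  where open ≡-Reasoning
bit-threeCopies E {Q} {p} Q< p<E true false = begin
    bit (threeCopies E Q) (p + E * 1)
  ≡⟨ cong (bit (threeCopies E Q)) (solve 2 (λ p E → p :+ E :* con 1 := E :+ p) refl p E) ⟩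
    bit (threeCopies E Q) (E + p)
  ≡⟨ bit-high E _ p Q< ⟩
    bit (Q + 2 ^ E * Q) p
  ≡⟨ bit-low E Q Q< p<E ⟩
    bit Q p
  ≡⟨ sym (∧-identityʳ (bit Q p)) ⟩
    bit Q p ∧ true ∎
  where open ≡-Reasoning
bit-threeCopies E {Q} {p} Q< p<E false true = begin
    bit (threeCopies E Q) (p + E * 2)
  ≡⟨ cong (bit (threeCopies E Q)) (solve 2 (λ p E → p :+ E :* con 2 := E :+ (E :+ p)) refl p E) ⟩
    bit (threeCopies E Q) (E + (E + p))
  ≡⟨ bit-high E _ (E + p) Q< ⟩
    bit (Q + 2 ^ E * Q) (E + p)
  ≡⟨ bit-high E Q p Q< ⟩
    bit Q p
  ≡⟨ sym (∧-identityʳ (bit Q p)) ⟩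
    bit Q p ∧ true ∎
  where open ≡-Reasoning
bit-threeCopies E {Q} {p} Q< p<E true true = begin
    bit (threeCopies E Q) (p + E * 3)
  ≡⟨ cong (bit (threeCopies E Q)) (solve 2 (λ p E → p :+ E :* con 3 := E :+ (E :+ (E :+ p))) refl p E) ⟩
    bit (threeCopies E Q) (E + (E + (E + p)))
  ≡⟨ bit-high E _ (E + (E + p)) Q< ⟩
    bit (Q + 2 ^ E * Q) (E + (E + p))
  ≡⟨ bit-high E Q (E + p) Q< ⟩
    bit Q (E + p)
  ≡⟨ bit-beyond (E + p) (<-≤-trans Q< (^-monoʳ-≤ 2 (m≤m+n E p))) ⟩
    false
  ≡⟨ sym (∧-zeroʳ (bit Q p)) ⟩
    bit Q p ∧ false ∎
  where open ≡-Reasoning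

threeCopies-bound : ∀ E {Q} → Q < 2 ^ E → threeCopies E Q < 2 ^ (E + (E + E))
threeCopies-bound E Q< = +-*2^-bound E (E + E) Q< (+-*2^-bound E E Q< Q<)

-- With E = 2 ^ (j * 2) and X = 2 ^ E, multiplying the index for j pairs by 1 + X + X * X places copies
-- of it at the offsets E * bin (a ∷ b ∷ []) of the appended pairs (a , b) other than (true , true).
pairFactor : ℕ → ℕ
pairFactor j = 1 + X + X * X
  where
  X : ℕ
  X = 2 ^ 2 ^ (j * 2)

pairFreeIndex : ℕ → ℕ
pairFreeIndex = prodBelow pairFactor

pairFreeIndex-suc : ∀ J → pairFreeIndex (suc J) ≡ threeCopies (2 ^ (J * 2)) (pairFreeIndex J)
pairFreeIndex-suc J = solve 2 (λ Q X → Q :* (con 1 :+ X :+ X :* X) := Q :+ X :* (Q :+ X :* Q))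
                              refl (pairFreeIndex J) (2 ^ 2 ^ (J * 2))

pairFreeIndex-bound : ∀ J → pairFreeIndex J < 2 ^ 2 ^ (J * 2)
pairFreeIndex-bound zero = s≤s (s≤s z≤n)
pairFreeIndex-bound (suc J) = begin-strict
    pairFreeIndex (suc J)
  ≡⟨ pairFreeIndex-suc J ⟩
    threeCopies E (pairFreeIndex J)
  <⟨ threeCopies-bound E (pairFreeIndex-bound J) ⟩
    2 ^ (E + (E + E))
  ≤⟨ ^-monoʳ-≤ 2 (≤-trans (m≤m+n (E + (E + E)) E)
                          (≤-reflexive (solve 1 (λ E → E :+ (E :+ E) :+ E := con 2 :* (con 2 :* E)) refl E))) ⟩
    2 ^ 2 ^ (suc J * 2) ∎
  where
  open ≤-Reasoning
  E : ℕ
  E = 2 ^ (J * 2)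

bit-pairFreeIndex : ∀ J σ → length σ ≡ J * 2 → bit (pairFreeIndex J) (bin σ) ≡ pairFree σ
bit-pairFreeIndex zero [] _ = refl
bit-pairFreeIndex (suc J) σ len with split-last-two (J * 2) σ len
... | ρ , a , b , σ≡ , ρ-len =
  subst (λ σ → bit (pairFreeIndex (suc J)) (bin σ) ≡ pairFree σ) (sym σ≡) (begin
    bit (pairFreeIndex (suc J)) (bin (ρ ++ a ∷ b ∷ []))
  ≡⟨ cong₂ bit (pairFreeIndex-suc J)
               (trans (bin-++ ρ (a ∷ b ∷ [])) (cong (λ v → bin ρ + v * bin (a ∷ b ∷ [])) 2^|ρ|)) ⟩
    bit (threeCopies E (pairFreeIndex J)) (bin ρ + E * bin (a ∷ b ∷ []))
  ≡⟨ bit-threeCopies E (pairFreeIndex-bound J) (subst (bin ρ <_) 2^|ρ| (bin<2^length ρ)) a b ⟩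
    bit (pairFreeIndex J) (bin ρ) ∧ not (a ∧ b)
  ≡⟨ cong (_∧ not (a ∧ b)) (bit-pairFreeIndex J ρ ρ-len) ⟩
    pairFree ρ ∧ not (a ∧ b)
  ≡⟨ sym (pairFree-++ J ρ a b ρ-len) ⟩
    pairFree (ρ ++ a ∷ b ∷ []) ∎)
  where
  open ≡-Reasoning
  E : ℕ
  E = 2 ^ (J * 2)
  2^|ρ| : 2 ^ length ρ ≡ E
  2^|ρ| = cong (2 ^_) ρ-len

count-pairFree : ∀ J → count pairFree (allStrings (J * 2)) ≡ 3 ^ J
count-pairFree zero = refl
count-pairFree (suc J) = begin
    count pairFree (allStrings (suc (suc (J * 2))))
  ≡⟨ count-allStrings-suc pairFree (suc (J * 2)) ⟩
    count (λ σ → pairFree (false ∷ σ)) (allStrings (suc (J * 2))) +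
    count (λ σ → pairFree (true ∷ σ)) (allStrings (suc (J * 2)))
  ≡⟨ cong₂ _+_ (count-allStrings-suc (λ σ → pairFree (false ∷ σ)) (J * 2))
               (count-allStrings-suc (λ σ → pairFree (true ∷ σ)) (J * 2)) ⟩
    (c + c) + (c + count (λ _ → false) (allStrings (J * 2)))
  ≡⟨ cong (λ v → (c + c) + (c + v)) (count-const false (J * 2)) ⟩
    (c + c) + (c + 0)
  ≡⟨ cong (λ v → (v + v) + (v + 0)) (count-pairFree J) ⟩
    (3 ^ J + 3 ^ J) + (3 ^ J + 0)
  ≡⟨ solve 1 (λ x → (x :+ x) :+ (x :+ con 0) := con 3 :* x) refl (3 ^ J) ⟩
    3 ^ suc J ∎
  where
  open ≡-Reasoning
  c : ℕ
  c = count pairFree (allStrings (J * 2))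

pairTestCode : ℕ → ℕ
pairTestCode n = levelCode (3 * n * 2) (pairFreeIndex (3 * n))

pairTestCode-primRec : PrimRec pairTestCode
pairTestCode-primRec =
  primRec-* (primRec-^ two (primRec-pred (primRec-^ two (primRec-* three·n two))))
            (primRec-∘ (primRec-prodBelow pairFactor-primRec) three·n)
  where
  two : PrimRec (λ _ → 2)
  two = primRec-const 2
  three·n : PrimRec (λ n → 3 * n)
  three·n = primRec-* (primRec-const 3) primRec-id
  2^2^[j*2] : PrimRec (λ j → 2 ^ 2 ^ (j * 2))
  2^2^[j*2] = primRec-^ two (primRec-^ two (primRec-* primRec-id two))
  pairFactor-primRec : PrimRec pairFactor
  pairFactor-primRec = primRec-+ (primRec-+ (primRec-const 1) 2^2^[j*2]) (primRec-* 2^2^[j*2] 2^2^[j*2])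

pairTest : PRF false 1
pairTest = proj₁ pairTestCode-primRec

∈D-pairTestCode : ∀ n σ → length σ ≡ 3 * n * 2 → σ ∈D pairTestCode n ≡ pairFree σ
∈D-pairTestCode n σ len = trans (∈D-levelCode (pairFreeIndex (3 * n)) σ len) (bit-pairFreeIndex (3 * n) σ len)

∈D-pairTestCode⁻ : ∀ n σ → σ ∈D pairTestCode n ≡ true →
                   length σ ≡ 3 * n * 2 × pairFree σ ≡ true
∈D-pairTestCode⁻ n σ σ∈ = len , trans (sym (∈D-pairTestCode n σ len)) σ∈
  where
  len : length σ ≡ 3 * n * 2
  len = levelCode-length σ (pairFreeIndex-bound (3 * n)) σ∈

any-inits : ∀ (p : List Bool → Bool) τ → any p (inits τ) ≡ true →
            ∃ λ k → k ≤ length τ × p (take k τ) ≡ true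
any-inits p τ any-true with p [] in p[]
... | true = 0 , z≤n , p[]
any-inits p (b ∷ τ) any-true | false
  with any-inits (λ σ → p (b ∷ σ)) τ (trans (cong or (map-∘ (inits τ))) any-true)
... | k , k≤ , pk = suc k , s≤s k≤ , pk

coveredBy-pairTestCode : ∀ n τ → coveredBy (pairTestCode n) τ ≡ true →
                         3 * n * 2 ≤ length τ × pairFree (take (3 * n * 2) τ) ≡ true
coveredBy-pairTestCode n τ covered with any-inits (_∈D pairTestCode n) τ covered
... | k , k≤ , prefix∈ with ∈D-pairTestCode⁻ n (take k τ) prefix∈
... | len , free = subst (_≤ length τ) k≡ k≤ , subst (λ k → pairFree (take k τ) ≡ true) k≡ free
  where
  k≡ : k ≡ 3 * n * 2
  k≡ = trans (sym (trans (length-take k τ) (m≤n⇒m⊓n≡m k≤))) len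

^-*-≤ : ∀ {a b c} n → a * b ≤ c → a ^ n * b ^ n ≤ c ^ n
^-*-≤ zero _ = ≤-refl
^-*-≤ {a} {b} {c} (suc n) ab≤c = begin
    a * a ^ n * (b * b ^ n)
  ≡⟨ solve 4 (λ a x b y → a :* x :* (b :* y) := (a :* b) :* (x :* y)) refl a (a ^ n) b (b ^ n) ⟩
    (a * b) * (a ^ n * b ^ n)
  ≤⟨ *-mono-≤ ab≤c (^-*-≤ n ab≤c) ⟩
    c * c ^ n ∎
  where open ≤-Reasoning

3^[3n]*2^n≤2^[3n*2] : ∀ n → 3 ^ (3 * n) * 2 ^ n ≤ 2 ^ (3 * n * 2)
3^[3n]*2^n≤2^[3n*2] n = begin
    3 ^ (3 * n) * 2 ^ n
  ≡⟨ cong (_* 2 ^ n) (sym (^-*-assoc 3 3 n)) ⟩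
    27 ^ n * 2 ^ n
  ≤⟨ ^-*-≤ n (m≤m+n 54 10) ⟩
    64 ^ n
  ≡⟨ ^-*-assoc 2 6 n ⟩
    2 ^ (6 * n)
  ≡⟨ cong (2 ^_) (solve 1 (λ n → con 6 :* n := con 3 :* n :* con 2) refl n) ⟩
    2 ^ (3 * n * 2) ∎
  where open ≤-Reasoning

pairTestCode-sparse : ∀ n L → count (coveredBy (pairTestCode n)) (allStrings L) * 2 ^ n ≤ 2 ^ L
pairTestCode-sparse n L with ≤-<-connex (3 * n * 2) L
... | inj₂ L<M = subst (λ c → c * 2 ^ n ≤ 2 ^ L) (sym none) z≤n
  where
  none : count (coveredBy (pairTestCode n)) (allStrings L) ≡ 0
  none = n≤0⇒n≡0 (≤-trans (count-mono L λ τ len covered →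
           contradiction (subst (3 * n * 2 ≤_) len (proj₁ (coveredBy-pairTestCode n τ covered))) (<⇒≱ L<M))
           (≤-reflexive (count-const false L)))
... | inj₁ M≤L = begin
    count (coveredBy (pairTestCode n)) (allStrings L) * 2 ^ n
  ≤⟨ *-monoˡ-≤ (2 ^ n) (count-mono L λ τ _ covered → proj₂ (coveredBy-pairTestCode n τ covered)) ⟩
    count (λ τ → pairFree (take M τ)) (allStrings L) * 2 ^ n
  ≡⟨ cong (λ L → count (λ τ → pairFree (take M τ)) (allStrings L) * 2 ^ n) (sym L≡) ⟩
    count (λ τ → pairFree (take M τ)) (allStrings (M + k)) * 2 ^ n
  ≡⟨ cong (_* 2 ^ n) (count-prefix M k pairFree) ⟩
    count pairFree (allStrings M) * 2 ^ k * 2 ^ n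
  ≡⟨ cong (λ c → c * 2 ^ k * 2 ^ n) (count-pairFree (3 * n)) ⟩
    3 ^ (3 * n) * 2 ^ k * 2 ^ n
  ≡⟨ solve 3 (λ a b c → a :* b :* c := a :* c :* b) refl (3 ^ (3 * n)) (2 ^ k) (2 ^ n) ⟩
    3 ^ (3 * n) * 2 ^ n * 2 ^ k
  ≤⟨ *-monoˡ-≤ (2 ^ k) (3^[3n]*2^n≤2^[3n*2] n) ⟩
    2 ^ M * 2 ^ k
  ≡⟨ sym (^-distribˡ-+-* 2 M k) ⟩
    2 ^ (M + k)
  ≡⟨ cong (2 ^_) L≡ ⟩
    2 ^ L ∎
  where
  open ≤-Reasoning
  M k : ℕ
  M = 3 * n * 2
  k = L ∸ M
  L≡ : M + k ≡ L
  L≡ = m+[n∸m]≡n M≤L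

pairTest-isTest : IsPRTest pairTest
pairTest-isTest n L = subst (λ c → count (coveredBy c) (allStrings L) * 2 ^ n ≤ 2 ^ L)
                            (sym (proj₂ pairTestCode-primRec n)) (pairTestCode-sparse n L)

Disjoint : Real → Real → Set
Disjoint A B = ∀ i → A i ∧ B i ≡ false

Disjoint-sym : ∀ {A B} → Disjoint A B → Disjoint B A
Disjoint-sym {A} {B} disjoint i = trans (∧-comm (B i) (A i)) (disjoint i)

pairFree-⊕ : ∀ {A B} → Disjoint A B → ∀ J → pairFree (applyUpTo (A ⊕ B) (J * 2)) ≡ true
pairFree-⊕ disjoint zero = refl
pairFree-⊕ disjoint (suc J) rewrite disjoint 0 = pairFree-⊕ (λ i → disjoint (suc i)) J

length-↾ : ∀ X n → length (X ↾ n) ≡ n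
length-↾ X n = trans (length-map X (upTo n)) (length-upTo n)

⊕-in-pairTest : ∀ {A B} → Disjoint A B → ∀ n → (A ⊕ B) ∈[D pr pairTest n ]
⊕-in-pairTest {A} {B} disjoint n = M , (begin
    ((A ⊕ B) ↾ M) ∈D pr pairTest n
  ≡⟨ cong (((A ⊕ B) ↾ M) ∈D_) (proj₂ pairTestCode-primRec n) ⟩
    ((A ⊕ B) ↾ M) ∈D pairTestCode n
  ≡⟨ ∈D-pairTestCode n ((A ⊕ B) ↾ M) (length-↾ (A ⊕ B) M) ⟩
    pairFree ((A ⊕ B) ↾ M)
  ≡⟨ cong pairFree (map-upTo (A ⊕ B) M) ⟩
    pairFree (applyUpTo (A ⊕ B) M)
  ≡⟨ pairFree-⊕ disjoint (3 * n) ⟩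
    true ∎)
  where
  open ≡-Reasoning
  M : ℕ
  M = 3 * n * 2

⊕-not-BPRandom : ∀ {A B} → Disjoint A B → ¬ BPRandom (A ⊕ B)
⊕-not-BPRandom disjoint random with random pairTest pairTest-isTest
... | n , ⊕-avoids = ⊕-avoids (⊕-in-pairTest disjoint n)

-- The use of an oracle computation

Agree : ℕ → Real → Real → Set
Agree n X Y = ∀ i → i < n → X i ≡ Y i

agree-≤ : ∀ {m n X Y} → m ≤ n → Agree n X Y → Agree m X Y
agree-≤ m≤n agree i i<m = agree i (<-≤-trans i<m m≤n)

maxFin : ∀ {m} → (Fin m → ℕ) → ℕ
maxFin {zero} f = 0
maxFin {suc m} f = f fzero ⊔ maxFin (λ i → f (fsuc i))

≤-maxFin : ∀ {m} (f : Fin m → ℕ) i → f i ≤ maxFin f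
≤-maxFin f fzero = m≤m⊔n (f fzero) _
≤-maxFin f (fsuc i) = ≤-trans (≤-maxFin (λ i → f (fsuc i)) i) (m≤n⊔m (f fzero) _)

use : ∀ {o n} → PRF o n → Real → Vec ℕ n → ℕ
use zeroF Z xs = 0
use succF Z xs = 0
use (proj i) Z xs = 0
use (comp h gs) Z xs = use h Z (tabulate (λ i → evalPR (gs i) Z xs)) ⊔ maxFin (λ i → use (gs i) Z xs)
use (prec g h) Z (y ∷ xs) = useUpTo y
  where
  useUpTo : ℕ → ℕ
  useUpTo zero = use g Z xs
  useUpTo (suc k) = useUpTo k ⊔ use h Z (k ∷ evalPR (prec g h) Z (k ∷ xs) ∷ xs)
use orc Z (x ∷ []) = suc x

evalPR-use : ∀ {o n} (t : PRF o n) Z Z′ xs → Agree (use t Z xs) Z Z′ → evalPR t Z xs ≡ evalPR t Z′ xs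
evalPR-use zeroF Z Z′ xs agree = refl
evalPR-use succF Z Z′ (x ∷ []) agree = refl
evalPR-use (proj i) Z Z′ xs agree = refl
evalPR-use (comp h gs) Z Z′ xs agree =
  trans (evalPR-use h Z Z′ _ (agree-≤ (m≤m⊔n _ _) agree))
        (cong (evalPR h Z′) (tabulate-cong λ i → evalPR-use (gs i) Z Z′ xs
          (agree-≤ (≤-trans (≤-maxFin (λ i → use (gs i) Z xs) i) (m≤n⊔m _ _)) agree)))
evalPR-use (prec g h) Z Z′ (y ∷ xs) = go y
  where
  go : ∀ y → Agree (use (prec g h) Z (y ∷ xs)) Z Z′ →
       evalPR (prec g h) Z (y ∷ xs) ≡ evalPR (prec g h) Z′ (y ∷ xs)
  go zero agree = evalPR-use g Z Z′ xs agree
  go (suc k) agree = trans (evalPR-use h Z Z′ _ (agree-≤ (m≤n⊔m _ _) agree))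
                           (cong (λ v → evalPR h Z′ (k ∷ v ∷ xs)) (go k (agree-≤ (m≤m⊔n _ _) agree)))
evalPR-use orc Z Z′ (x ∷ []) agree = cong (λ b → if b then 1 else 0) (agree x ≤-refl)

-- Enumerating the oracle tests

nextPair : ℕ × ℕ → ℕ × ℕ
nextPair (a , suc b) = suc a , b
nextPair (a , zero) = zero , suc a

unpair : ℕ → ℕ × ℕ
unpair zero = 0 , 0
unpair (suc n) = nextPair (unpair n)

unpair-surjective : ∀ a b → ∃ λ n → unpair n ≡ (a , b)
unpair-surjective a b = onDiagonal (a + b) a b refl
  where
  onDiagonal : ∀ s a b → a + b ≡ s → ∃ λ n → unpair n ≡ (a , b)
  onDiagonal s zero zero _ = 0 , refl
  onDiagonal s (suc a) b a+b≡s with onDiagonal s a (suc b) (trans (+-suc a b) a+b≡s)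
  ... | n , unpair-n = suc n , cong nextPair unpair-n
  onDiagonal (suc s) zero (suc b) b≡s with onDiagonal s b zero (trans (+-identityʳ b) (suc-injective b≡s))
  ... | n , unpair-n = suc n , cong nextPair unpair-n

pair : ℕ → ℕ → ℕ
pair a b = proj₁ (unpair-surjective a b)

unpair-pair : ∀ a b → unpair (pair a b) ≡ (a , b)
unpair-pair a b = proj₂ (unpair-surjective a b)

toFin : ∀ n → ℕ → Fin (suc n)
toFin zero _ = fzero
toFin (suc n) zero = fzero
toFin (suc n) (suc r) = fsuc (toFin n r)

toFin-toℕ : ∀ n (i : Fin (suc n)) → toFin n (toℕ i) ≡ i
toFin-toℕ zero fzero = refl
toFin-toℕ (suc n) fzero = refl
toFin-toℕ (suc n) (fsuc i) = cong fsuc (toFin-toℕ n i)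

mutual
  decode : (fuel : ℕ) (o : Bool) (n : ℕ) → ℕ → PRF o n
  decode zero o n c = zeroF
  decode (suc fuel) o n c = decodeTagged fuel o n (proj₁ (unpair c)) (proj₂ (unpair c))

  -- The clauses for tags 0 and 3 come first so that they compute for every arity n.
  decodeTagged : (fuel : ℕ) (o : Bool) (n : ℕ) (tag : ℕ) → ℕ → PRF o n
  decodeTagged fuel o n 0 c = zeroF
  decodeTagged fuel o n 3 c = comp (decode fuel o m (proj₁ (unpair (proj₂ (unpair c)))))
                                   (decodeFamily fuel o n m (proj₂ (unpair (proj₂ (unpair c)))))
    where
    m : ℕ
    m = proj₁ (unpair c)
  decodeTagged fuel o (suc zero) 1 c = succF
  decodeTagged fuel o (suc n) 2 c = proj (toFin n c)
  decodeTagged fuel o (suc n) 4 c = prec (decode fuel o n (proj₁ (unpair c)))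
                                         (decode fuel o (suc (suc n)) (proj₂ (unpair c)))
  decodeTagged fuel true (suc zero) 5 c = orc
  decodeTagged fuel o n _ c = zeroF

  decodeFamily : (fuel : ℕ) (o : Bool) (n m : ℕ) → ℕ → Fin m → PRF o n
  decodeFamily fuel o n (suc m) c fzero = decode fuel o n (proj₁ (unpair c))
  decodeFamily fuel o n (suc m) c (fsuc i) = decodeFamily fuel o n m (proj₂ (unpair c)) i

_≃_ : ∀ {o n} → PRF o n → PRF o n → Set
t ≃ u = ∀ Z xs → evalPR t Z xs ≡ evalPR u Z xs

Decodable : ∀ {o n} → PRF o n → Set
Decodable {o} {n} t = ∃ λ c → ∃ λ fuel → ∀ fuel′ → fuel ≤ fuel′ → decode fuel′ o n c ≃ t

decode-pair : ∀ fuel o n tag c → decode (suc fuel) o n (pair tag c) ≡ decodeTagged fuel o n tag c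
decode-pair fuel o n tag c rewrite unpair-pair tag c = refl

decodableFamily : ∀ {o n m} (gs : Fin m → PRF o n) → (∀ i → Decodable (gs i)) →
  ∃ λ c → ∃ λ fuel → ∀ fuel′ → fuel ≤ fuel′ → ∀ i → decodeFamily fuel′ o n m c i ≃ gs i
decodableFamily {m = zero} gs _ = 0 , 0 , λ _ _ ()
decodableFamily {o} {n} {suc m} gs gs-decodable
  with gs-decodable fzero | decodableFamily (λ i → gs (fsuc i)) (λ i → gs-decodable (fsuc i))
... | c₀ , f₀ , g₀≃ | cs , fs , gs≃ = pair c₀ cs , f₀ ⊔ fs , λ where
  fuel enough fzero Z xs →
    subst (λ p → evalPR (decode fuel o n (proj₁ p)) Z xs ≡ evalPR (gs fzero) Z xs)
          (sym (unpair-pair c₀ cs)) (g₀≃ fuel (≤-trans (m≤m⊔n f₀ fs) enough) Z xs)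
  fuel enough (fsuc i) Z xs →
    subst (λ p → evalPR (decodeFamily fuel o n m (proj₂ p) i) Z xs ≡ evalPR (gs (fsuc i)) Z xs)
          (sym (unpair-pair c₀ cs)) (gs≃ fuel (≤-trans (m≤n⊔m f₀ fs) enough) i Z xs)

decodable-tagged : ∀ {o n} (t : PRF o n) tag c fuel →
                   (∀ fuel′ → fuel ≤ fuel′ → decodeTagged fuel′ o n tag c ≃ t) → Decodable t
decodable-tagged {o} {n} t tag c fuel tagged≃ = pair tag c , suc fuel , λ where
  (suc fuel′) (s≤s enough) Z xs →
    trans (cong (λ u → evalPR u Z xs) (decode-pair fuel′ o n tag c)) (tagged≃ fuel′ enough Z xs)

decodable : ∀ {o n} (t : PRF o n) → Decodable t
decodable zeroF = decodable-tagged zeroF 0 0 0 λ _ _ _ _ → refl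
decodable succF = decodable-tagged succF 1 0 0 λ _ _ _ _ → refl
decodable {n = suc n} (proj i) =
  decodable-tagged (proj i) 2 (toℕ i) 0 λ _ _ Z xs → cong (lookup xs) (toFin-toℕ n i)
decodable {o} {n} (comp {m = m} h gs) with decodable h | decodableFamily gs (λ i → decodable (gs i))
... | ch , fh , h≃ | cgs , fgs , gs≃ = decodable-tagged (comp h gs) 3 (pair m (pair ch cgs)) (fh ⊔ fgs) comp≃
  where
  comp≃ : ∀ fuel → fh ⊔ fgs ≤ fuel → decodeTagged fuel o n 3 (pair m (pair ch cgs)) ≃ comp h gs
  comp≃ fuel enough Z xs rewrite unpair-pair m (pair ch cgs) | unpair-pair ch cgs =
    trans (h≃ fuel (≤-trans (m≤m⊔n fh fgs) enough) Z _)
          (cong (evalPR h Z) (tabulate-cong λ i → gs≃ fuel (≤-trans (m≤n⊔m fh fgs) enough) i Z xs))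
decodable {o} {suc n} (prec g h) with decodable g | decodable h
... | cg , fg , g≃ | ch , fh , h≃ = decodable-tagged (prec g h) 4 (pair cg ch) (fg ⊔ fh) prec≃
  where
  prec≃ : ∀ fuel → fg ⊔ fh ≤ fuel → decodeTagged fuel o (suc n) 4 (pair cg ch) ≃ prec g h
  prec≃ fuel enough Z (y ∷ xs) rewrite unpair-pair cg ch = go y
    where
    go : ∀ y → evalPR (prec (decode fuel o n cg) (decode fuel o (suc (suc n)) ch)) Z (y ∷ xs) ≡
               evalPR (prec g h) Z (y ∷ xs)
    go zero = g≃ fuel (≤-trans (m≤m⊔n fg fh) enough) Z xs
    go (suc k) = trans (h≃ fuel (≤-trans (m≤n⊔m fg fh) enough) Z _)
                       (cong (λ v → evalPR h Z (k ∷ v ∷ xs)) (go k))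
decodable orc = decodable-tagged orc 5 0 0 λ _ _ _ _ → refl

decodeCode : (o : Bool) (n : ℕ) → ℕ → PRF o n
decodeCode o n c = decode (proj₁ (unpair c)) o n (proj₂ (unpair c))

decodeCode-surjective : ∀ {o n} (t : PRF o n) → ∃ λ c → decodeCode o n c ≃ t
decodeCode-surjective {o} {n} t with decodable t
... | c , fuel , decode≃ = pair fuel c , subst (λ p → decode (proj₁ p) o n (proj₂ p) ≃ t)
                                               (sym (unpair-pair fuel c)) (decode≃ fuel ≤-refl)

testAt : ℕ → PRF true 1 × PRF false 1
testAt e = decodeCode true 1 (proj₁ (unpair e)) , decodeCode false 1 (proj₂ (unpair e))

testAt-surjective : ∀ g f → ∃ λ e → proj₁ (testAt e) ≃ g × proj₂ (testAt e) ≃ f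
testAt-surjective g f with decodeCode-surjective g | decodeCode-surjective f
... | cg , g≃ | cf , f≃ =
  pair cg cf , subst (λ p → decodeCode true 1 (proj₁ p) ≃ g × decodeCode false 1 (proj₂ p) ≃ f)
                     (sym (unpair-pair cg cf)) (g≃ , f≃)

Escapes : PRF true 1 → PRF false 1 → Real → Real → ℕ → Set
Escapes g f X Y n = ¬ (((X ↾ pr f n) ∈D prO g Y n) ≡ true)

isOracleTest-≃ : ∀ {g g′ f f′} → g′ ≃ g → f′ ≃ f → IsOracleTest g f → IsOracleTest g′ f′
isOracleTest-≃ g≃ f≃ valid Z n =
  subst₂ (λ c L → count (_∈D c) (allStrings L) * 2 ^ n < 2 ^ L)
         (sym (g≃ Z (n ∷ []))) (sym (f≃ noOracle (n ∷ []))) (valid Z n)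

Escapes-≃ : ∀ {g g′ f f′} X Y n → g′ ≃ g → f′ ≃ f → Escapes g′ f′ X Y n → Escapes g f X Y n
Escapes-≃ X Y n g≃ f≃ escapes X∈ =
  escapes (subst₂ (λ L c → (X ↾ L) ∈D c ≡ true) (sym (f≃ noOracle (n ∷ []))) (sym (g≃ Y (n ∷ []))) X∈)

-- The finite-extension construction

padZeros : List Bool → Real
padZeros [] _ = false
padZeros (b ∷ σ) zero = b
padZeros (b ∷ σ) (suc i) = padZeros σ i

padZeros-↾ : ∀ σ → padZeros σ ↾ length σ ≡ σ
padZeros-↾ σ = trans (map-upTo (padZeros σ) (length σ)) (go σ)
  where
  go : ∀ σ → applyUpTo (padZeros σ) (length σ) ≡ σ
  go [] = refl
  go (b ∷ σ) = cong (b ∷_) (go σ)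

padZeros-++ : ∀ σ τ → Agree (length σ) (padZeros (σ ++ τ)) (padZeros σ)
padZeros-++ (b ∷ σ) τ zero _ = refl
padZeros-++ (b ∷ σ) τ (suc i) (s≤s i<) = padZeros-++ σ τ i i<

padZeros-beyond : ∀ σ i → length σ ≤ i → padZeros σ i ≡ false
padZeros-beyond [] i _ = refl
padZeros-beyond (b ∷ σ) (suc i) (s≤s |σ|≤i) = padZeros-beyond σ i |σ|≤i

padZeros-agrees : ∀ X n → Agree n (padZeros (X ↾ n)) X
padZeros-agrees X n i i<n rewrite map-upTo X n = go X n i i<n
  where
  go : ∀ X n i → i < n → padZeros (applyUpTo X n) i ≡ X i
  go X (suc n) zero _ = refl
  go X (suc n) (suc i) (s≤s i<n) = go (λ j → X (suc j)) n i i<n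

↾-agree : ∀ {X Y} n → Agree n X Y → X ↾ n ≡ Y ↾ n
↾-agree {X} {Y} n agree = trans (map-upTo X n) (trans (go X Y n agree) (sym (map-upTo Y n)))
  where
  go : ∀ X Y n → Agree n X Y → applyUpTo X n ≡ applyUpTo Y n
  go X Y zero _ = refl
  go X Y (suc n) agree = cong₂ _∷_ (agree 0 (s≤s z≤n)) (go _ _ n λ i i<n → agree (suc i) (s≤s i<n))

take-↾ : ∀ X {m n} → m ≤ n → take m (X ↾ n) ≡ X ↾ m
take-↾ X {m} {n} m≤n = trans (take-map m (upTo n)) (cong (map X) (go id m≤n))
  where
  go : ∀ (f : ℕ → ℕ) {m n} → m ≤ n → take m (applyUpTo f n) ≡ applyUpTo f m
  go f z≤n = refl
  go f (s≤s m≤n) = cong (f 0 ∷_) (go (λ i → f (suc i)) m≤n)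

limit : (ℕ → Real) → Real
limit xs i = xs (suc i) i

module Limit (lv : ℕ → ℕ) (xs : ℕ → Real) (lv-< : ∀ e → lv e < lv (suc e))
             (step : ∀ e → Agree (lv e) (xs (suc e)) (xs e)) where

  e≤lv : ∀ e → e ≤ lv e
  e≤lv zero = z≤n
  e≤lv (suc e) = ≤-<-trans (e≤lv e) (lv-< e)

  lv-mono : ∀ d e → lv e ≤ lv (d + e)
  lv-mono zero e = ≤-refl
  lv-mono (suc d) e = ≤-trans (lv-mono d e) (<⇒≤ (lv-< (d + e)))

  stable : ∀ d e → Agree (lv e) (xs (d + e)) (xs e)
  stable zero e i i<lv = refl
  stable (suc d) e i i<lv = trans (step (d + e) i (<-≤-trans i<lv (lv-mono d e))) (stable d e i i<lv)

  limit-agrees : ∀ e → Agree (lv e) (limit xs) (xs e)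
  limit-agrees e i i<lv with ≤-total (suc i) e
  ... | inj₁ 1+i≤e = trans (sym (stable (e ∸ suc i) (suc i) i (≤-<-trans (e≤lv i) (lv-< i))))
                           (cong (λ e → xs e i) (m∸n+n≡m 1+i≤e))
  ... | inj₂ e≤1+i = trans (cong (λ e → xs e i) (sym (m∸n+n≡m e≤1+i))) (stable (suc i ∸ e) e i i<lv)

-- A stage of the construction; only the bits below level are final.
record Approx : Set where
  constructor approx
  field
    level : ℕ
    left right : Real
open Approx

swap : Approx → Approx
swap s = approx (level s) (right s) (left s)

_⊏_ : Approx → Approx → Set
s ⊏ t = level s < level t × Agree (level s) (left t) (left s) × Agree (level s) (right t) (right s)

⊏-trans : ∀ {s t u} → s ⊏ t → t ⊏ u → s ⊏ u
⊏-trans (s<t , leftₛₜ , rightₛₜ) (t<u , leftₜᵤ , rightₜᵤ) =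
  <-trans s<t t<u ,
  (λ i i<s → trans (leftₜᵤ i (<-trans i<s s<t)) (leftₛₜ i i<s)) ,
  (λ i i<s → trans (rightₜᵤ i (<-trans i<s s<t)) (rightₛₜ i i<s))

swap-⊏ : ∀ {s t} → s ⊏ t → swap s ⊏ swap t
swap-⊏ (s<t , leftₛₜ , rightₛₜ) = s<t , rightₛₜ , leftₛₜ

Extends : Approx → Real → Real → Set
Extends s A B = Agree (level s) A (left s) × Agree (level s) B (right s)

Extends-⊏ : ∀ {s t A B} → s ⊏ t → Extends t A B → Extends s A B
Extends-⊏ (s<t , leftₛₜ , rightₛₜ) (A≈ , B≈) =
  (λ i i<s → trans (A≈ i (<-trans i<s s<t)) (leftₛₜ i i<s)) ,
  (λ i i<s → trans (B≈ i (<-trans i<s s<t)) (rightₛₜ i i<s))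

module Extension (g : PRF true 1) (f : PRF false 1) (s : Approx) where

  -- Cutting the oracle at level keeps the reals disjoint; the new level lies beyond the extended string and
  -- the use of g on the oracle, so later stages cannot undo the escape.
  oracle : Real
  oracle = padZeros (right s ↾ level s)

  L : ℕ
  L = pr f (level s)

  G : ℕ
  G = prO g oracle (level s)

  prefix : List Bool
  prefix = left s ↾ level s

  inG : List Bool → Bool
  inG τ = take L τ ∈D G

  suffix : List Bool
  suffix = avoider (λ ρ → inG (prefix ++ ρ)) L

  extended : Approx
  extended = approx (suc (level s + L + use g oracle (level s ∷ []))) (padZeros (prefix ++ suffix)) oracle

  |prefix| : length prefix ≡ level s
  |prefix| = length-↾ (left s) (level s)

  left-preserved : Agree (level s) (left extended) (left s)
  left-preserved i i<ℓ = trans (padZeros-++ prefix suffix i (subst (i <_) (sym |prefix|) i<ℓ))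
                               (padZeros-agrees (left s) (level s) i i<ℓ)

  right-preserved : Agree (level s) (right extended) (right s)
  right-preserved = padZeros-agrees (right s) (level s)

  ⊏-extended : s ⊏ extended
  ⊏-extended = s≤s (≤-trans (m≤m+n (level s) L) (m≤m+n (level s + L) _)) , left-preserved , right-preserved

  oracle-beyond : ∀ i → level s ≤ i → oracle i ≡ false
  oracle-beyond i ℓ≤i =
    padZeros-beyond (right s ↾ level s) i (subst (_≤ i) (sym (length-↾ (right s) (level s))) ℓ≤i)

  extended-disjoint : Disjoint (left s) (right s) → Disjoint (left extended) (right extended)
  extended-disjoint disjoint i with <-≤-connex i (level s)
  ... | inj₁ i<ℓ = trans (cong₂ _∧_ (left-preserved i i<ℓ) (right-preserved i i<ℓ)) (disjoint i)
  ... | inj₂ ℓ≤i = trans (cong (left extended i ∧_) (oracle-beyond i ℓ≤i)) (∧-zeroʳ (left extended i))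

  module _ (valid : IsOracleTest g f) where

    few-bad-suffixes : count (λ ρ → inG (prefix ++ ρ)) (allStrings L) < 2 ^ L
    few-bad-suffixes = begin-strict
        count (λ ρ → inG (prefix ++ ρ)) (allStrings L)
      ≤⟨ count-extensions inG prefix L ⟩
        count inG (allStrings (length prefix + L))
      ≡⟨ cong (λ n → count inG (allStrings n)) (trans (cong (_+ L) |prefix|) (+-comm (level s) L)) ⟩
        count inG (allStrings (L + level s))
      ≡⟨ count-prefix L (level s) (_∈D G) ⟩
        count (_∈D G) (allStrings L) * 2 ^ level s
      <⟨ valid oracle (level s) ⟩
        2 ^ L ∎
      where open ≤-Reasoning

    escapes : ∀ X Y → Extends extended X Y → Escapes g f X Y (level s)
    escapes X Y (X≈ , Y≈) X∈G = contradiction (trans (sym bad) X∈G) λ ()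
      where
      open ≡-Reasoning
      N : ℕ
      N = level s + L
      good : length suffix ≡ L × inG (prefix ++ suffix) ≡ false
      good = avoider-avoids _ L few-bad-suffixes
      |prefix++suffix| : length (prefix ++ suffix) ≡ N
      |prefix++suffix| = trans (length-++ prefix) (cong₂ _+_ |prefix| (proj₁ good))
      X↾L : X ↾ L ≡ take L (prefix ++ suffix)
      X↾L = begin
          X ↾ L
        ≡⟨ sym (take-↾ X (m≤n+m L (level s))) ⟩
          take L (X ↾ N)
        ≡⟨ cong (take L) (↾-agree N (agree-≤ (≤-trans (m≤m+n N _) (n≤1+n _)) X≈)) ⟩
          take L (padZeros (prefix ++ suffix) ↾ N)
        ≡⟨ cong (λ n → take L (padZeros (prefix ++ suffix) ↾ n)) (sym |prefix++suffix|) ⟩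
          take L (padZeros (prefix ++ suffix) ↾ length (prefix ++ suffix))
        ≡⟨ cong (take L) (padZeros-↾ (prefix ++ suffix)) ⟩
          take L (prefix ++ suffix) ∎
      G≡ : prO g Y (level s) ≡ G
      G≡ = sym (evalPR-use g oracle Y (level s ∷ [])
                  (λ i i<u → sym (Y≈ i (<-trans i<u (s≤s (m≤n+m _ N))))))
      bad : (X ↾ L) ∈D prO g Y (level s) ≡ false
      bad = trans (cong₂ _∈D_ X↾L G≡) (proj₂ good)

extend : PRF true 1 × PRF false 1 → Approx → Approx
extend (g , f) = Extension.extended g f

stage : PRF true 1 × PRF false 1 → Approx → Approx
stage t s = swap (extend t (swap (extend t s)))

⊏-extend : ∀ t s → s ⊏ extend t s
⊏-extend (g , f) = Extension.⊏-extended g f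

⊏-stage : ∀ t s → extend t s ⊏ stage t s
⊏-stage t s = swap-⊏ (⊏-extend t (swap (extend t s)))

stage-disjoint : ∀ t s → Disjoint (left s) (right s) → Disjoint (left (stage t s)) (right (stage t s))
stage-disjoint (g , f) s disjoint =
  Disjoint-sym {left s₂} (Extension.extended-disjoint g f (swap s₁)
    (Disjoint-sym {left s₁} (Extension.extended-disjoint g f s disjoint)))
  where
  s₁ s₂ : Approx
  s₁ = extend (g , f) s
  s₂ = extend (g , f) (swap s₁)

approxAt : ℕ → Approx
approxAt zero = approx 0 (λ _ → false) (λ _ → false)
approxAt (suc e) = stage (testAt e) (approxAt e)

testAt-escapes : ∀ {g f} e → proj₁ (testAt e) ≃ g → proj₂ (testAt e) ≃ f → IsOracleTest g f →
                 ∀ s X Y → Extends (extend (testAt e) s) X Y → Escapes g f X Y (level s)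
testAt-escapes {g} {f} e g≃ f≃ valid s X Y extends =
  Escapes-≃ {g} {proj₁ (testAt e)} {f} {proj₂ (testAt e)} X Y (level s) g≃ f≃
    (Extension.escapes (proj₁ (testAt e)) (proj₂ (testAt e)) s
      (isOracleTest-≃ {g} {proj₁ (testAt e)} {f} {proj₂ (testAt e)} g≃ f≃ valid) X Y extends)

⊏-approxAt : ∀ e → approxAt e ⊏ approxAt (suc e)
⊏-approxAt e = ⊏-trans (⊏-extend (testAt e) (approxAt e)) (⊏-stage (testAt e) (approxAt e))

limitA limitB : Real
limitA = limit (λ e → left (approxAt e))
limitB = limit (λ e → right (approxAt e))

limits-extend : ∀ e → Extends (approxAt e) limitA limitB
limits-extend e =
  Limit.limit-agrees levels (λ e → left (approxAt e)) levels-< (λ e → proj₁ (proj₂ (⊏-approxAt e))) e ,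
  Limit.limit-agrees levels (λ e → right (approxAt e)) levels-< (λ e → proj₂ (proj₂ (⊏-approxAt e))) e
  where
  levels : ℕ → ℕ
  levels e = level (approxAt e)
  levels-< : ∀ e → levels e < levels (suc e)
  levels-< e = proj₁ (⊏-approxAt e)

approxAt-disjoint : ∀ e → Disjoint (left (approxAt e)) (right (approxAt e))
approxAt-disjoint zero i = refl
approxAt-disjoint (suc e) = stage-disjoint (testAt e) (approxAt e) (approxAt-disjoint e)

limits-disjoint : Disjoint limitA limitB
limits-disjoint i = approxAt-disjoint (suc i) i

limitA-random-rel-limitB : BPRandomRel limitA limitB
limitA-random-rel-limitB g f valid with testAt-surjective g f
... | e , g≃ , f≃ = level (approxAt e) ,
  testAt-escapes {g} {f} e g≃ f≃ valid (approxAt e) limitA limitB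
                 (Extends-⊏ (⊏-stage (testAt e) (approxAt e)) (limits-extend (suc e)))

limitB-random-rel-limitA : BPRandomRel limitB limitA
limitB-random-rel-limitA g f valid with testAt-surjective g f
... | e , g≃ , f≃ = level (extend (testAt e) (approxAt e)) ,
  testAt-escapes {g} {f} e g≃ f≃ valid (swap (extend (testAt e) (approxAt e))) limitB limitA
                 (×-swap (limits-extend (suc e)))

theorem2p16 : Σ Real (λ A → Σ Real (λ B →
      BPRandomRel A B × BPRandomRel B A × ¬ BPRandom (A ⊕ B)))
theorem2p16 = limitA , limitB , limitA-random-rel-limitB , limitB-random-rel-limitA , ⊕-not-BPRandom limits-disjoint
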